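{- Let $F$ be a graph and let $\mathcal{H}$ be a hypergraph on $n$ vertices that is both $F$-free and $C_2$-free. If every hyperedge of $\mathcal{H}$ has size at least 2, then $|\mathcal{H}|\le \mathrm{ex}(n,F)$.
   Context: For a graph $G$ (possibly with parallel edges), a hypergraph $\mathcal{B}$ is a Berge-$G$ if there is a bijection $f:E(G)\to E(\mathcal{B})$ with $e\subseteq f(e)$ for every $e\in E(G)$ (vertices of $G$ identified with distinct vertices of the hypergraph). A hypergraph is $G$-free if no subfamily of its hyperedges is a Berge-$G$. $C_2$ is the graph on two vertices with two parallel edges, so a hypergraph is $C_2$-free exactly when any two distinct hyperedges (including copies of the same set) share at most one vertex. $\mathrm{ex}(n,F)$ is the maximum number of edges of an $F$-free simple graph on $n$ vertices. -}

module Defs where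

open import Data.Nat using (ℕ; _≤_; _≥_)
open import Data.Fin using (Fin; zero; suc)
open import Data.Fin.Subset using (Subset; _∈_; ∣_∣)
open import Data.List using (List; length; lookup; _∷_; [])
open import Data.List.Relation.Unary.All using (All)
open import Data.List.Relation.Unary.Unique.Propositional using (Unique)
open import Data.Product using (Σ; _×_; _,_; proj₁; proj₂; ∃)
open import Relation.Binary.PropositionalEquality using (_≡_; _≢_)
open import Relation.Nullary using (¬_)
open import Function.Definitions using (Injective)

-- A (loopless) graph, possibly with parallel edges:
-- vertex set Fin verts, edges a list of ordered pairs of distinct vertices.
record Graph : Set where
  field
    verts : ℕ
    edges : List (Fin verts × Fin verts)
    loopless : All (λ e → proj₁ e ≢ proj₂ e) edges
open Graph public

-- A hypergraph on vertex set Fin n: a list (multiset) of hyperedges,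
-- each a subset of Fin n.  Copies of the same set are allowed.
Hypergraph : ℕ → Set
Hypergraph n = List (Subset n)

record BergeCopy {n : ℕ} (G : Graph) (ℋ : Hypergraph n) : Set where
  field
    φ : Fin (verts G) → Fin n
    φ-inj : Injective _≡_ _≡_ φ
    f : Fin (length (edges G)) → Fin (length ℋ)
    f-inj : Injective _≡_ _≡_ f
    contains : ∀ i → (φ (proj₁ (lookup (edges G) i)) ∈ lookup ℋ (f i))
                   × (φ (proj₂ (lookup (edges G) i)) ∈ lookup ℋ (f i))

Free : {n : ℕ} → Graph → Hypergraph n → Set
Free G ℋ = ¬ BergeCopy G ℋ

C₂ : Graph
C₂ = record
  { verts = 2
  ; edges = (zero , suc zero) ∷ (zero , suc zero) ∷ []
  ; loopless = (λ ()) All.∷ ((λ ()) All.∷ All.[])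
  }

record SimpleGraph (n : ℕ) : Set where
  field
    E : List (Subset n)
    two : All (λ e → ∣ e ∣ ≡ 2) E
    distinct : Unique E
open SimpleGraph public

-- F-free simple graph (a simple graph viewed as a 2-uniform hypergraph;
-- for a 2-uniform hypergraph with distinct edges, Berge-F = copy of F).
FreeSimple : {n : ℕ} → Graph → SimpleGraph n → Set
FreeSimple F G = Free F (E G)

IsEx : ℕ → Graph → ℕ → Set
IsEx n F m =
  (Σ (SimpleGraph n) λ G → FreeSimple F G × length (E G) ≡ m)
  × (∀ (G : SimpleGraph n) → FreeSimple F G → length (E G) ≤ m)

module Submission where

-- Replace every hyperedge e of ℋ by its "2-shadow": the set of
-- its first two members (e has at least two).  The resulting list of 2-sets is
--   * F-free, because each 2-set lies inside the hyperedge it came from, so a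
--     Berge copy of F among the 2-sets is also a Berge copy of F in ℋ;
--   * duplicate-free, because two different hyperedges with the same shadow
--     share two distinct vertices, i.e. they form a Berge-C₂.
-- Hence it is an F-free simple graph on n vertices with |ℋ| edges, and the
-- maximality half of ex(n,F) bounds |ℋ|.

open import Defs
open import Data.Nat using (ℕ; zero; suc; _≤_; _≥_; s≤s)
open import Data.Nat.Properties using (≤-reflexive)
open import Data.Fin using (Fin; zero; suc; _≟_)
open import Data.Fin.Properties using (suc-injective; 0≢1+n)
open import Data.Fin.Subset using (Subset; Nonempty; _∈_; _⊆_; ∣_∣; ⊥; inside; outside)
open import Data.Fin.Subset.Properties using (⊥⊆; ∣⊥∣≡0)
open import Data.Vec using ([]; _∷_; here; there)
open import Data.List using (List; []; _∷_; length; map; lookup)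
open import Data.List.Properties using (length-map)
open import Data.List.Relation.Unary.All as All using (All)
open import Data.List.Relation.Unary.All.Properties using (map⁺)
open import Data.List.Relation.Unary.AllPairs using ([]; _∷_)
open import Data.List.Relation.Unary.Any.Properties using (lookup-index)
open import Data.List.Relation.Unary.Unique.Propositional using (Unique)
open import Data.List.Membership.Propositional.Properties using (∈-lookup)
open import Data.Product using (Σ; _×_; _,_)
open import Relation.Binary.PropositionalEquality using (_≡_; _≢_; refl; sym; trans; cong; subst)
open import Relation.Nullary using (yes; no; contradiction)
open import Function.Definitions using (Injective)

private
  variable
    n : ℕ
    A B : Set

firstMembers : ℕ → Subset n → Subset n
firstMembers zero    p             = ⊥
firstMembers (suc k) []            = []
firstMembers (suc k) (inside ∷ p)  = inside ∷ firstMembers k p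
firstMembers (suc k) (outside ∷ p) = outside ∷ firstMembers (suc k) p

-- Truncation only removes members; this is what lets Berge copies lift back.
firstMembers-⊆ : ∀ k (p : Subset n) → firstMembers k p ⊆ p
firstMembers-⊆ zero    p             x∈ = ⊥⊆ x∈
firstMembers-⊆ (suc k) (inside ∷ p)  here       = here
firstMembers-⊆ (suc k) (inside ∷ p)  (there x∈) = there (firstMembers-⊆ k p x∈)
firstMembers-⊆ (suc k) (outside ∷ p) (there x∈) = there (firstMembers-⊆ (suc k) p x∈)

∣firstMembers∣ : ∀ k (p : Subset n) → k ≤ ∣ p ∣ → ∣ firstMembers k p ∣ ≡ k
∣firstMembers∣ {n} zero p _                   = ∣⊥∣≡0 n
∣firstMembers∣ (suc k) (inside ∷ p) (s≤s k≤) = cong suc (∣firstMembers∣ k p k≤)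
∣firstMembers∣ (suc k) (outside ∷ p) k<      = ∣firstMembers∣ (suc k) p k<

∣p∣≥1⇒Nonempty : (p : Subset n) → ∣ p ∣ ≥ 1 → Nonempty p
∣p∣≥1⇒Nonempty (inside ∷ p)  _  = zero , here
∣p∣≥1⇒Nonempty (outside ∷ p) 1≤ with ∣p∣≥1⇒Nonempty p 1≤
... | x , x∈p = suc x , there x∈p

twoDistinctMembers : (p : Subset n) → ∣ p ∣ ≥ 2 →
  Σ (Fin n) λ a → Σ (Fin n) λ b → a ≢ b × a ∈ p × b ∈ p
twoDistinctMembers (inside ∷ p) (s≤s 1≤) with ∣p∣≥1⇒Nonempty p 1≤
... | b , b∈p = zero , suc b , 0≢1+n , here , there b∈p
twoDistinctMembers (outside ∷ p) 2≤ with twoDistinctMembers p 2≤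
... | a , b , a≢b , a∈p , b∈p =
  suc a , suc b , (λ eq → a≢b (suc-injective eq)) , there a∈p , there b∈p

unmap : (g : A → B) (xs : List A) → Fin (length (map g xs)) → Fin (length xs)
unmap g (x ∷ xs) zero    = zero
unmap g (x ∷ xs) (suc i) = suc (unmap g xs i)

lookup-map : (g : A → B) (xs : List A) (i : Fin (length (map g xs))) →
  lookup (map g xs) i ≡ g (lookup xs (unmap g xs i))
lookup-map g (x ∷ xs) zero    = refl
lookup-map g (x ∷ xs) (suc i) = lookup-map g xs i

unmap-injective : (g : A → B) (xs : List A) → Injective _≡_ _≡_ (unmap g xs)
unmap-injective g (x ∷ xs) {zero}  {zero}  _  = refl
unmap-injective g (x ∷ xs) {suc i} {suc j} eq =
  cong suc (unmap-injective g xs (suc-injective eq))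

lookup-injective⇒Unique : (xs : List A) → Injective _≡_ _≡_ (lookup xs) → Unique xs
lookup-injective⇒Unique []       _   = []
lookup-injective⇒Unique (x ∷ xs) inj =
  All.tabulate (λ y∈xs x≡y → 0≢1+n (inj (trans x≡y (lookup-index y∈xs))))
  ∷ lookup-injective⇒Unique xs (λ eq → suc-injective (inj eq))

shrink-Free : (G : Graph) (g : Subset n → Subset n) → (∀ e → g e ⊆ e) →
  (ℋ : Hypergraph n) → Free G ℋ → Free G (map g ℋ)
shrink-Free G g g⊆ ℋ free copy = free record
  { φ        = φ
  ; φ-inj    = φ-inj
  ; f        = λ i → unmap g ℋ (f i)
  ; f-inj    = λ eq → f-inj (unmap-injective g ℋ eq)
  ; contains = λ i → let (u∈ , v∈) = contains i in lift i u∈ , lift i v∈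
  }
  where
  open BergeCopy copy
  lift : ∀ i {x} → x ∈ lookup (map g ℋ) (f i) → x ∈ lookup ℋ (unmap g ℋ (f i))
  lift i x∈ = g⊆ _ (subst (_ ∈_) (lookup-map g ℋ (f i)) x∈)

pair : A → A → Fin 2 → A
pair x y zero       = x
pair x y (suc zero) = y

pair-injective : {x y : A} → x ≢ y → Injective _≡_ _≡_ (pair x y)
pair-injective x≢y {zero}     {zero}     _  = refl
pair-injective x≢y {zero}     {suc zero} eq = contradiction eq x≢y
pair-injective x≢y {suc zero} {zero}     eq = contradiction (sym eq) x≢y
pair-injective x≢y {suc zero} {suc zero} _  = refl

sharedPair⇒C₂ : (ℋ : Hypergraph n) {i j : Fin (length ℋ)} {a b : Fin n} →
  i ≢ j → a ≢ b →
  a ∈ lookup ℋ i → b ∈ lookup ℋ i → a ∈ lookup ℋ j → b ∈ lookup ℋ j →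
  BergeCopy C₂ ℋ
sharedPair⇒C₂ ℋ {i} {j} {a} {b} i≢j a≢b a∈i b∈i a∈j b∈j = record
  { φ        = pair a b
  ; φ-inj    = pair-injective a≢b
  ; f        = pair i j
  ; f-inj    = pair-injective i≢j
  ; contains = λ { zero → a∈i , b∈i ; (suc zero) → a∈j , b∈j }
  }

shadow : Subset n → Subset n
shadow = firstMembers 2

-- Two different hyperedges of size ≥ 2 with the same shadow form a Berge-C₂:
-- both contain the two distinct members of the common shadow.
equalShadows⇒C₂ : (ℋ : Hypergraph n) {i j : Fin (length ℋ)} → i ≢ j →
  ∣ lookup ℋ i ∣ ≥ 2 → shadow (lookup ℋ i) ≡ shadow (lookup ℋ j) → BergeCopy C₂ ℋ
equalShadows⇒C₂ ℋ {i} {j} i≢j big same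
  with twoDistinctMembers (shadow (lookup ℋ i))
         (≤-reflexive (sym (∣firstMembers∣ 2 (lookup ℋ i) big)))
... | a , b , a≢b , a∈s , b∈s =
  sharedPair⇒C₂ ℋ i≢j a≢b (inI a∈s) (inI b∈s) (inJ a∈s) (inJ b∈s)
  where
  inI : ∀ {x} → x ∈ shadow (lookup ℋ i) → x ∈ lookup ℋ i
  inI = firstMembers-⊆ 2 (lookup ℋ i)
  inJ : ∀ {x} → x ∈ shadow (lookup ℋ i) → x ∈ lookup ℋ j
  inJ x∈ = firstMembers-⊆ 2 (lookup ℋ j) (subst (_ ∈_) same x∈)

shadows-injective : (ℋ : Hypergraph n) → Free C₂ ℋ → All (λ e → ∣ e ∣ ≥ 2) ℋ →
  Injective _≡_ _≡_ (lookup (map shadow ℋ))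
shadows-injective ℋ freeC₂ big {i} {j} same
  with unmap shadow ℋ i ≟ unmap shadow ℋ j
... | yes i≡j = unmap-injective shadow ℋ i≡j
... | no  i≢j = contradiction (equalShadows⇒C₂ ℋ i≢j (All.lookup big (∈-lookup _)) same′) freeC₂
  where
  same′ : shadow (lookup ℋ (unmap shadow ℋ i)) ≡ shadow (lookup ℋ (unmap shadow ℋ j))
  same′ = trans (sym (lookup-map shadow ℋ i)) (trans same (lookup-map shadow ℋ j))

shadowGraph : (ℋ : Hypergraph n) → Free C₂ ℋ → All (λ e → ∣ e ∣ ≥ 2) ℋ → SimpleGraph n
shadowGraph ℋ freeC₂ big = record
  { E        = map shadow ℋ
  ; two      = map⁺ (All.map (λ {e} → ∣firstMembers∣ 2 e) big)
  ; distinct = lookup-injective⇒Unique (map shadow ℋ) (shadows-injective ℋ freeC₂ big)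
  }

mainTheorem9 : (F : Graph) (n : ℕ) (ℋ : Hypergraph n)
    → Free F ℋ → Free C₂ ℋ → All (λ e → ∣ e ∣ ≥ 2) ℋ
    → (m : ℕ) → IsEx n F m → length ℋ ≤ m
mainTheorem9 F n ℋ freeF freeC₂ big m (_ , maximal) =
  subst (_≤ m) (length-map shadow ℋ) (maximal G G-free)
  where
  G : SimpleGraph n
  G = shadowGraph ℋ freeC₂ big
  G-free : FreeSimple F G
  G-free = shrink-Free F shadow (firstMembers-⊆ 2) ℋ freeF
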